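{- Let $b\geq3$ and $t\geq1$ be integers. Let $T$ be a tree with exactly $b$ leaves and diameter at most $4t+2$. Then the maximum matching number of $T$ is at most $bt+1$.
   Context: Leaves are vertices of degree $1$; the diameter is the maximum distance between two vertices; the maximum matching number is the largest number of pairwise vertex-disjoint edges. -}

module Defs where

open import Data.Bool using (Bool; true; false; T)
open import Data.Nat using (ℕ; _≤_; _≡ᵇ_)
open import Data.Fin using (Fin)
open import Data.List using (List; []; _∷_; length; filterᵇ; allFin; concatMap)
open import Data.List.Relation.Unary.All using (All)
open import Data.List.Relation.Unary.Linked using (Linked)
open import Data.List.Relation.Unary.Unique.Propositional using (Unique)
open import Data.Product using (Σ; _×_; _,_; ∃; ∃-syntax)
open import Relation.Binary.PropositionalEquality using (_≡_)

record Graph (n : ℕ) : Set where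
  field
    adj     : Fin n → Fin n → Bool
    symm    : ∀ u v → adj u v ≡ adj v u
    irrefl  : ∀ v → adj v v ≡ false

module _ {n : ℕ} (G : Graph n) where
  open Graph G

  Adj : Fin n → Fin n → Set
  Adj u v = T (adj u v)

  data Walk : Fin n → Fin n → ℕ → Set where
    here : ∀ {u} → Walk u u 0
    step : ∀ {u v w k} → Adj u v → Walk v w k → Walk u w (Data.Nat.suc k)

  Connected : Set
  Connected = ∀ u v → ∃[ k ] Walk u v k

  lastOf : Fin n → List (Fin n) → Fin n
  lastOf v []       = v
  lastOf v (x ∷ xs) = lastOf x xs

  IsCycle : Fin n → List (Fin n) → Set
  IsCycle v xs = Linked Adj (v ∷ xs) × Unique (v ∷ xs)
               × 2 ≤ length xs × Adj (lastOf v xs) v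

  Acyclic : Set
  Acyclic = ∀ v xs → IsCycle v xs → Data.Empty.⊥
    where import Data.Empty

  IsTree : Set
  IsTree = Connected × Acyclic

  degree : Fin n → ℕ
  degree u = length (filterᵇ (adj u) (allFin n))

  numLeaves : ℕ
  numLeaves = length (filterᵇ (λ v → degree v ≡ᵇ 1) (allFin n))

  DiameterAtMost : ℕ → Set
  DiameterAtMost D = ∀ u v → ∃[ k ] (k ≤ D × Walk u v k)

  IsMatching : List (Fin n × Fin n) → Set
  IsMatching M = All (λ { (u , v) → Adj u v }) M
               × Unique (concatMap (λ { (u , v) → u ∷ v ∷ [] }) M)

  MatchingNumberAtMost : ℕ → Set
  MatchingNumberAtMost m = ∀ M → IsMatching M → length M ≤ m

-- Root the tree at a centre: a diameter of at most 2(2t + 1) leaves a vertex c with every vertex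
-- within distance 2t + 1. Every edge joins a vertex v ≠ c to its parent and is labelled by v: all
-- vertices of depth 1 get one common label, and a vertex of depth d ≥ 2 gets the pair
-- (a leaf below v, ⌊(d − 2)/2⌋ < t). Vertices with equal labels lie on one path from the root at
-- depths differing by at most one, so their parent edges meet. Hence the edges of a matching carry
-- distinct labels, of which there are only bt + 1.

module Submission where

open import Defs
open import Data.Nat using (ℕ; _≤_; _+_; _*_)
open import Relation.Binary.PropositionalEquality using (_≡_)

open import Data.Bool using (T)
open import Data.Bool.Properties using (T?)
open import Data.Empty using (⊥; ⊥-elim)
open import Data.Fin as Fin using (Fin; combine; remQuot; fromℕ<; toℕ)
import Data.Fin.Properties as Finₚ
open Finₚ using (injective⇒≤; remQuot-combine; toℕ-fromℕ<; ¬∀⟶∃¬)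
open import Data.List using (List; []; _∷_; [_]; _++_; length; map; lookup; filterᵇ; allFin)
open import Data.List.Membership.Propositional using (_∈_; _∉_; lose)
open import Data.List.Membership.Propositional.Properties
  using (∈-lookup; ∈-filter⁺; ∈-filter⁻; ∈-allFin; ∈-concatMap⁺)
open import Data.List.Membership.Setoid.Properties using (index-injective)
open import Data.List.Properties using (length-map; length-++)
open import Data.List.Relation.Binary.Subset.Propositional using (_⊆_)
open import Data.List.Relation.Unary.All as All using (All; []; _∷_)
open import Data.List.Relation.Unary.All.Properties using (¬Any⇒All¬; map⁺; ++⁺)
open import Data.List.Relation.Unary.AllPairs using ([]; _∷_)
open import Data.List.Relation.Unary.Any using (here; there; index)
open import Data.List.Relation.Unary.Linked using (Linked; [-]; _∷_)
open import Data.List.Relation.Unary.Unique.Propositional using (Unique)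
import Data.List.Relation.Unary.Unique.Propositional.Properties as Unique
open import Data.Nat using (zero; suc; _<_; _∸_; ⌊_/2⌋; _≡ᵇ_; z≤n; s≤s; s≤s⁻¹)
open import Data.Nat.Properties
open import Data.Nat.Tactic.RingSolver using (solve-∀)
open import Data.Product using (_×_; _,_; proj₁; proj₂; ∃-syntax)
open import Data.Product.Properties using (,-injectiveˡ; ,-injectiveʳ)
open import Data.Sum using (_⊎_; inj₁; inj₂; [_,_]′)
open import Function using (_∘_; id)
open import Relation.Binary using (tri<; tri≈; tri>)
open import Relation.Binary.PropositionalEquality
  using (_≢_; refl; sym; trans; cong; cong₂; subst; subst₂; setoid; module ≡-Reasoning)
open import Relation.Nullary using (¬_; Dec; yes; no)
open import Relation.Nullary.Decidable using (_×-dec_)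
open import Relation.Unary using (Decidable)

least : {P : ℕ → Set} → Decidable P → ∀ {m} → P m →
        ∃[ k ] P k × (∀ {j} → P j → k ≤ j)
least {P} P? {m} pm = [ id , (λ none → ⊥-elim (none ≤-refl pm)) ]′ (search (suc m))
  where
  search : ∀ m → (∃[ k ] P k × (∀ {j} → P j → k ≤ j)) ⊎ (∀ {j} → j < m → ¬ P j)
  search zero = inj₂ λ ()
  search (suc m) with search m
  ... | inj₁ found = inj₁ found
  ... | inj₂ none with P? m
  ...   | yes pm = inj₁ (m , pm , λ pj → ≮⇒≥ λ j<m → none j<m pj)
  ...   | no ¬pm = inj₂ λ j<1+m → [ none , (λ { refl → ¬pm }) ]′ (m<1+n⇒m<n∨m≡n j<1+m)

⌊n/2⌋<m : ∀ {n m} → n < m + m → ⌊ n /2⌋ < m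
⌊n/2⌋<m {0}           {suc m} _ = s≤s z≤n
⌊n/2⌋<m {1}           {suc m} _ = s≤s z≤n
⌊n/2⌋<m {suc (suc n)} {suc m} (s≤s n+1<m+1+m) =
  s≤s (⌊n/2⌋<m (s≤s⁻¹ (≤-trans n+1<m+1+m (≤-reflexive (+-suc m m)))))

⌊m/2⌋≡⌊n/2⌋⇒m≤1+n : ∀ m n → ⌊ m /2⌋ ≡ ⌊ n /2⌋ → m ≤ suc n
⌊m/2⌋≡⌊n/2⌋⇒m≤1+n 0             _             _  = z≤n
⌊m/2⌋≡⌊n/2⌋⇒m≤1+n 1             _             _  = s≤s z≤n
⌊m/2⌋≡⌊n/2⌋⇒m≤1+n (suc (suc m)) (suc (suc n)) eq =
  s≤s (s≤s (⌊m/2⌋≡⌊n/2⌋⇒m≤1+n m n (suc-injective eq)))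

combine-injective : ∀ {m n} {i i′ : Fin m} {j j′ : Fin n} →
                    combine i j ≡ combine i′ j′ → i ≡ i′ × j ≡ j′
combine-injective {n = n} {i} {i′} {j} {j′} eq = ,-injectiveˡ pairs , ,-injectiveʳ pairs
  where
  pairs : (i , j) ≡ (i′ , j′)
  pairs = trans (sym (remQuot-combine i j)) (trans (cong (remQuot n) eq) (remQuot-combine i′ j′))

module _ {A : Set} where

  Unique-lookup-injective : ∀ {xs : List A} → Unique xs → ∀ i j → lookup xs i ≡ lookup xs j → i ≡ j
  Unique-lookup-injective (_ ∷ _)      Fin.zero    Fin.zero    _  = refl
  Unique-lookup-injective (x∉xs ∷ _)   Fin.zero    (Fin.suc j) eq = ⊥-elim (All.lookup x∉xs (∈-lookup j) eq)
  Unique-lookup-injective (x∉xs ∷ _)   (Fin.suc i) Fin.zero    eq = ⊥-elim (All.lookup x∉xs (∈-lookup i) (sym eq))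
  Unique-lookup-injective (_ ∷ unique) (Fin.suc i) (Fin.suc j) eq =
    cong Fin.suc (Unique-lookup-injective unique i j eq)

  Unique-snoc : ∀ {xs : List A} {y} → Unique xs → y ∉ xs → Unique (xs ++ [ y ])
  Unique-snoc unique y∉xs = Unique.++⁺ unique ([] ∷ []) λ { (y∈xs , here refl) → y∉xs y∈xs }

∃-other-member : ∀ {n} {x : Fin n} {xs} → Unique xs → x ∈ xs → length xs ≢ 1 → ∃[ y ] y ∈ xs × y ≢ x
∃-other-member {xs = []}        _               ()
∃-other-member {xs = _ ∷ []}    _               _ length≢1 = ⊥-elim (length≢1 refl)
∃-other-member {x = x} {a ∷ b ∷ _} ((a≢b ∷ _) ∷ _) _ _ with a Finₚ.≟ x
... | yes refl = b , there (here refl) , a≢b ∘ sym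
... | no a≢x   = a , here refl , a≢x

Unique⇒length≤ : ∀ {K} {xs : List (Fin K)} → Unique xs → length xs ≤ K
Unique⇒length≤ unique = injective⇒≤ (Unique-lookup-injective unique _ _)

module GraphLemmas {n : ℕ} (G : Graph n) where
  open Graph G using (adj; symm; irrefl)

  adj-sym : ∀ {u v} → Adj G u v → Adj G v u
  adj-sym {u} {v} = subst T (symm u v)

  adj⇒≢ : ∀ {u v} → Adj G u v → u ≢ v
  adj⇒≢ {u} uv refl = subst T (irrefl u) uv

  snoc : ∀ {u v w k} → Walk G u v k → Adj G v w → Walk G u w (suc k)
  snoc here         vw = step vw here
  snoc (step uv vw) wx = step uv (snoc vw wx)

  walk? : ∀ k u v → Dec (Walk G u v k)
  walk? zero u v with u Finₚ.≟ v
  ... | yes refl = yes here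
  ... | no u≢v   = no λ { here → u≢v refl }
  walk? (suc k) u v with Finₚ.any? (λ w → T? (adj u w) ×-dec walk? k w v)
  ... | yes (w , uw , wv) = yes (step uw wv)
  ... | no ∄w             = no λ { (step uw wv) → ∄w (_ , uw , wv) }

  lastOf-snoc : ∀ v xs y → lastOf G v (xs ++ [ y ]) ≡ y
  lastOf-snoc v []       y = refl
  lastOf-snoc v (x ∷ xs) y = lastOf-snoc x xs y

  Linked-snoc : ∀ {v} xs {y} → Linked (Adj G) (v ∷ xs) → Adj G (lastOf G v xs) y →
                Linked (Adj G) (v ∷ xs ++ [ y ])
  Linked-snoc []       _            last-y = last-y ∷ [-]
  Linked-snoc (x ∷ xs) (vx ∷ linked) last-y = vx ∷ Linked-snoc xs linked last-y

  endpoints : Fin n × Fin n → List (Fin n)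
  endpoints (u , w) = u ∷ w ∷ []

  leaves : List (Fin n)
  leaves = filterᵇ (λ v → degree G v ≡ᵇ 1) (allFin n)

  ShareEndpoint : Fin n × Fin n → Fin n × Fin n → Set
  ShareEndpoint e e′ = ∃[ z ] z ∈ endpoints e × z ∈ endpoints e′

  matching-bound : ∀ {K} (label : Fin n × Fin n → Fin K) →
                   (∀ {u w u′ w′} → Adj G u w → Adj G u′ w′ →
                    label (u , w) ≡ label (u′ , w′) → ShareEndpoint (u , w) (u′ , w′)) →
                   MatchingNumberAtMost G K
  matching-bound label share M matching =
    subst (_≤ _) (length-map label M) (Unique⇒length≤ (labels-unique M matching))
    where
    labels-unique : ∀ M → IsMatching G M → Unique (map label M)
    labels-unique []             _ = []
    labels-unique ((u , w) ∷ M) (uw ∷ edges , (_ ∷ u∉) ∷ w∉ ∷ unique) =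
      map⁺ (All.tabulate fresh) ∷ labels-unique M (edges , unique)
      where
      fresh : ∀ {e} → e ∈ M → label (u , w) ≢ label e
      fresh e∈M same with share uw (All.lookup edges e∈M) same
      ... | z , here refl ,         z∈e = All.lookup u∉ (∈-concatMap⁺ endpoints (lose e∈M z∈e)) refl
      ... | z , there (here refl) , z∈e = All.lookup w∉ (∈-concatMap⁺ endpoints (lose e∈M z∈e)) refl

  DiameterAtMost-mono : ∀ {D D′} → D ≤ D′ → DiameterAtMost G D → DiameterAtMost G D′
  DiameterAtMost-mono D≤D′ diam x y with diam x y
  ... | k , k≤D , walk = k , ≤-trans k≤D D≤D′ , walk

  empty-walk : ∀ {u v k} → Walk G u v k → k ≡ 0 → u ≡ v
  empty-walk here _ = refl

  second : ∀ {u v k} → Walk G u v k → Fin n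
  second {u} here           = u
  second (step {v = w} _ _) = w

  second-empty : ∀ {u v k} (p : Walk G u v k) → k ≡ 0 → second p ≡ u
  second-empty here _ = refl

  uncons : ∀ {u v k j} (p : Walk G u v k) → k ≡ suc j → Adj G u (second p) × Walk G (second p) v j
  uncons (step uw wv) refl = uw , wv

module Rooted {n : ℕ} {G : Graph n} (tree : IsTree G) (root : Fin n) where
  open GraphLemmas G
  open Graph G using (adj)

  opaque
    private
      geodesic : ∀ x → ∃[ k ] Walk G x root k × (∀ {j} → Walk G x root j → k ≤ j)
      geodesic x = least (λ k → walk? k x root) (proj₂ (proj₁ tree x root))

    depth : Fin n → ℕ
    depth x = proj₁ (geodesic x)

    depth-walk : ∀ x → Walk G x root (depth x)
    depth-walk x = proj₁ (proj₂ (geodesic x))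

    depth-minimal : ∀ {x k} → Walk G x root k → depth x ≤ k
    depth-minimal {x} = proj₂ (proj₂ (geodesic x))

  depth≡0⇒root : ∀ {x} → depth x ≡ 0 → x ≡ root
  depth≡0⇒root {x} = empty-walk (depth-walk x)

  depth-adj : ∀ {u v} → Adj G u v → depth u ≤ suc (depth v)
  depth-adj uv = depth-minimal (step uv (depth-walk _))

  depth-along : ∀ {u v k} → Walk G u v k → depth v ≤ depth u + k
  depth-along {u} here = ≤-reflexive (sym (+-identityʳ (depth u)))
  depth-along {u} {v} (step {v = u₁} {k = k} uu₁ walk) = begin
    depth v        ≤⟨ depth-along walk ⟩
    depth u₁ + k   ≤⟨ +-monoˡ-≤ k (depth-adj (adj-sym uu₁)) ⟩
    suc (depth u + k) ≡⟨ +-suc (depth u) k ⟨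
    depth u + suc k   ∎
    where open ≤-Reasoning

  parent : Fin n → Fin n
  parent x = second (depth-walk x)

  IsParent : Fin n → Fin n → Set
  IsParent p v = parent v ≡ p × depth v ≡ suc (depth p)

  parent-step : ∀ {x d} → depth x ≡ suc d → Adj G x (parent x) × depth (parent x) ≡ d
  parent-step {x} eq with uncons (depth-walk x) eq
  ... | x-px , px-root =
    x-px , ≤-antisym (depth-minimal px-root) (s≤s⁻¹ (subst (_≤ suc (depth (parent x))) eq (depth-adj x-px)))

  depth-parent : ∀ x → depth (parent x) ≡ depth x ∸ 1
  depth-parent x = from-depth (depth x) refl
    where
    from-depth : ∀ d → depth x ≡ d → depth (parent x) ≡ d ∸ 1
    from-depth zero    eq = trans (cong depth (second-empty (depth-walk x) eq)) eq
    from-depth (suc d) eq = proj₂ (parent-step eq)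

  parent-adj : ∀ {x} → 1 ≤ depth x → Adj G x (parent x)
  parent-adj 1≤d = proj₁ (parent-step (sym (m+[n∸m]≡n 1≤d)))

  parent-of-depth-1 : ∀ {x} → depth x ≡ 1 → parent x ≡ root
  parent-of-depth-1 eq = depth≡0⇒root (proj₂ (parent-step eq))

  private
    shallower-∉ : ∀ {d w xs} → All (λ z → suc d ≤ depth z) xs → depth w ≡ d → w ∉ xs
    shallower-∉ deep dw w∈xs = 1+n≰n (≤-trans (All.lookup deep w∈xs) (≤-reflexive dw))

  -- Two distinct vertices of depth d joined by a path through depths ≥ d close a cycle together
  -- with their paths up to the first common ancestor.
  no-level-path : ∀ d {x y} P → depth x ≡ d → depth y ≡ d → x ≢ y →
                  All (λ z → d ≤ depth z) (x ∷ P ++ [ y ]) →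
                  Linked (Adj G) (x ∷ P ++ [ y ]) → Unique (x ∷ P ++ [ y ]) → ⊥
  no-level-path zero _ dx dy x≢y _ _ _ = x≢y (trans (depth≡0⇒root dx) (sym (depth≡0⇒root dy)))
  no-level-path (suc d) {x} {y} P dx dy x≢y deep linked unique
    with parent-step dx | parent-step dy | parent x Finₚ.≟ parent y
  ... | x-px , dpx | y-py , dpy | yes px≡py =
    proj₂ tree (parent x) (x ∷ P ++ [ y ])
      ( adj-sym x-px ∷ linked
      , ¬Any⇒All¬ _ (shallower-∉ deep dpx) ∷ unique
      , s≤s (subst (1 ≤_) (sym (length-++ P)) (m≤n+m 1 (length P)))
      , subst₂ (Adj G) (sym (lastOf-snoc x P y)) (sym px≡py) y-py )
  ... | x-px , dpx | y-py , dpy | no px≢py =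
    no-level-path d (x ∷ P ++ [ y ]) dpx dpy px≢py
      (≤-reflexive (sym dpx) ∷ ++⁺ (All.map (≤-trans (n≤1+n d)) deep) (≤-reflexive (sym dpy) ∷ []))
      (adj-sym x-px ∷ Linked-snoc (P ++ [ y ]) linked (subst (λ z → Adj G z (parent y)) (sym (lastOf-snoc x P y)) y-py))
      (++⁺ (¬Any⇒All¬ _ (shallower-∉ deep dpx)) (px≢py ∷ []) ∷ Unique-snoc unique (shallower-∉ deep dpy))

  level-edge-absurd : ∀ {u w} → Adj G u w → depth u ≡ depth w → ⊥
  level-edge-absurd uw eq =
    no-level-path _ [] refl (sym eq) (adj⇒≢ uw) (≤-refl ∷ ≤-reflexive eq ∷ []) (uw ∷ [-])
      ((adj⇒≢ uw ∷ []) ∷ [] ∷ [])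

  parent-unique : ∀ {u w} → Adj G u w → depth w ≡ suc (depth u) → parent w ≡ u
  parent-unique {u} {w} uw dw with parent w Finₚ.≟ u | parent-step dw
  ... | yes pw≡u | _ = pw≡u
  ... | no pw≢u | w-pw , dpw = ⊥-elim
    (no-level-path _ (w ∷ []) refl dpw (pw≢u ∘ sym)
      (≤-refl ∷ ≤-trans (n≤1+n _) (≤-reflexive (sym dw)) ∷ ≤-reflexive (sym dpw) ∷ [])
      (uw ∷ w-pw ∷ [-])
      ((adj⇒≢ uw ∷ (pw≢u ∘ sym) ∷ []) ∷ (adj⇒≢ w-pw ∷ []) ∷ [] ∷ []))

  edge-joins-parent : ∀ {u w} → Adj G u w → IsParent w u ⊎ IsParent u w
  edge-joins-parent {u} {w} uw with <-cmp (depth u) (depth w)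
  ... | tri< u<w _ _ = inj₂ (parent-unique uw dw , dw)
    where
    dw : depth w ≡ suc (depth u)
    dw = ≤-antisym (depth-adj (adj-sym uw)) u<w
  ... | tri≈ _ eq _ = ⊥-elim (level-edge-absurd uw eq)
  ... | tri> _ _ w<u = inj₁ (parent-unique (adj-sym uw) du , du)
    where
    du : depth u ≡ suc (depth w)
    du = ≤-antisym (depth-adj uw) w<u

  ancestor : ℕ → Fin n → Fin n
  ancestor zero    x = x
  ancestor (suc j) x = ancestor j (parent x)

  ancestor-suc : ∀ j x → ancestor (suc j) x ≡ parent (ancestor j x)
  ancestor-suc zero    x = refl
  ancestor-suc (suc j) x = ancestor-suc j (parent x)

  depth-ancestor : ∀ j x → depth (ancestor j x) ≡ depth x ∸ j
  depth-ancestor zero    x = refl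
  depth-ancestor (suc j) x = begin
    depth (ancestor j (parent x)) ≡⟨ depth-ancestor j (parent x) ⟩
    depth (parent x) ∸ j          ≡⟨ cong (_∸ j) (depth-parent x) ⟩
    depth x ∸ 1 ∸ j               ≡⟨ ∸-+-assoc (depth x) 1 j ⟩
    depth x ∸ suc j               ∎
    where open ≡-Reasoning

  ancestor-walk : ∀ j x → j ≤ depth x → Walk G x (ancestor j x) j
  ancestor-walk zero    x _   = here
  ancestor-walk (suc j) x j<d =
    step (parent-adj (≤-trans (s≤s z≤n) j<d))
         (ancestor-walk j (parent x) (subst (j ≤_) (sym (depth-parent x)) (∸-monoˡ-≤ 1 j<d)))

  ancestor-depth-injective : ∀ i j x → depth (ancestor i x) ≡ depth (ancestor j x) → ancestor i x ≡ ancestor j x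
  ancestor-depth-injective i j x eq = by-depth (depth (ancestor i x)) refl
    where
    ≤depth : ∀ k {s} → depth (ancestor k x) ≡ suc s → k ≤ depth x
    ≤depth k dk = <⇒≤ (m∸n≢0⇒n<m λ d∸k≡0 → 1+n≢0 (trans (sym dk) (trans (depth-ancestor k x) d∸k≡0)))
    by-depth : ∀ d → depth (ancestor i x) ≡ d → ancestor i x ≡ ancestor j x
    by-depth zero    di = trans (depth≡0⇒root di) (sym (depth≡0⇒root (trans (sym eq) di)))
    by-depth (suc _) di = cong (λ k → ancestor k x)
      (∸-cancelˡ-≡ (≤depth i di) (≤depth j (trans (sym eq) di))
        (trans (sym (depth-ancestor i x)) (trans eq (depth-ancestor j x))))

  ancestor-parent : ∀ i j x → depth (ancestor j x) ≡ suc (depth (ancestor i x)) →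
                    parent (ancestor j x) ≡ ancestor i x
  ancestor-parent i j x dj = sym (trans
    (ancestor-depth-injective i (suc j) x (sym (begin
      depth (ancestor (suc j) x)     ≡⟨ cong depth (ancestor-suc j x) ⟩
      depth (parent (ancestor j x))  ≡⟨ depth-parent (ancestor j x) ⟩
      depth (ancestor j x) ∸ 1       ≡⟨ cong (_∸ 1) dj ⟩
      depth (ancestor i x)           ∎)))
    (ancestor-suc j x))
    where open ≡-Reasoning

  parent-edge : Fin n → Fin n × Fin n
  parent-edge v = v , parent v

  nearby-ancestors-share : ∀ {x i j u w} → ancestor i x ≡ u → ancestor j x ≡ w →
                           depth u ≤ suc (depth w) → depth w ≤ suc (depth u) →
                           ShareEndpoint (parent-edge u) (parent-edge w)
  nearby-ancestors-share {x} {i} {j} refl refl u≤ w≤ with <-cmp (depth (ancestor i x)) (depth (ancestor j x))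
  ... | tri< u<w _ _ = _ , here refl , there (here (sym (ancestor-parent i j x (≤-antisym w≤ u<w))))
  ... | tri≈ _ u≡w _ = _ , here refl , here (ancestor-depth-injective i j x u≡w)
  ... | tri> _ _ w<u = _ , there (here (sym (ancestor-parent j i x (≤-antisym u≤ w<u)))) , here refl

  branch : Fin n → Fin n
  branch x = ancestor (depth x ∸ 1) x

  depth-branch : ∀ {x} → 1 ≤ depth x → depth (branch x) ≡ 1
  depth-branch {x} 1≤d = trans (depth-ancestor (depth x ∸ 1) x) (m∸[m∸n]≡n 1≤d)

  branch-walk : ∀ x → Walk G x (branch x) (depth x ∸ 1)
  branch-walk x = ancestor-walk (depth x ∸ 1) x (m∸n≤m (depth x) 1)

  branch-parent : ∀ {x} → 2 ≤ depth x → branch (parent x) ≡ branch x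
  branch-parent {x} 2≤d = begin
    ancestor (depth (parent x) ∸ 1) (parent x) ≡⟨ cong (λ d → ancestor (d ∸ 1) (parent x)) (depth-parent x) ⟩
    ancestor (depth x ∸ 1 ∸ 1) (parent x)      ≡⟨ cong (λ j → ancestor j x) (m+[n∸m]≡n (∸-monoˡ-≤ 1 2≤d)) ⟩
    ancestor (depth x ∸ 1) x                   ∎
    where open ≡-Reasoning

  cross-branch-parent : ∀ {p v} → IsParent p v → branch v ≢ branch p → depth p ≡ 0
  cross-branch-parent {p} {v} (pv≡p , dv) differ = by-depth (depth p) refl
    where
    by-depth : ∀ d → depth p ≡ d → depth p ≡ 0
    by-depth zero    dp = dp
    by-depth (suc _) dp = ⊥-elim (differ (trans (sym (branch-parent 2≤dv)) (cong branch pv≡p)))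
      where
      2≤dv : 2 ≤ depth v
      2≤dv = subst (2 ≤_) (sym (trans dv (cong suc dp))) (s≤s (s≤s z≤n))

  cross-branch-edge : ∀ {u w} → Adj G u w → branch u ≢ branch w → depth u + depth w ≡ 1
  cross-branch-edge {u} {w} uw differ with edge-joins-parent uw
  ... | inj₁ w-parent@(_ , du) = cong₂ _+_ (trans du (cong suc dw)) dw
    where
    dw : depth w ≡ 0
    dw = cross-branch-parent w-parent differ
  ... | inj₂ u-parent@(_ , dw) = cong₂ _+_ du (trans dw (cong suc du))
    where
    du : depth u ≡ 0
    du = cross-branch-parent u-parent (differ ∘ sym)

  walk-across-branches : ∀ {x y k} → Walk G x y k → branch x ≢ branch y → depth x + depth y ≤ k
  walk-across-branches here differ = ⊥-elim (differ refl)
  walk-across-branches {x} {y} (step {v = x₁} {k = k} xx₁ walk) differ with branch x₁ Finₚ.≟ branch y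
  ... | no differ₁ = begin
    depth x + depth y         ≤⟨ +-monoˡ-≤ (depth y) (depth-adj xx₁) ⟩
    suc (depth x₁ + depth y)  ≤⟨ s≤s (walk-across-branches walk differ₁) ⟩
    suc k                     ∎
    where open ≤-Reasoning
  ... | yes same = begin
    depth x + depth y          ≤⟨ +-monoʳ-≤ (depth x) (depth-along walk) ⟩
    depth x + (depth x₁ + k)   ≡⟨ +-assoc (depth x) (depth x₁) k ⟨
    depth x + depth x₁ + k     ≡⟨ cong (_+ k) (cross-branch-edge xx₁ λ bx≡bx₁ → differ (trans bx≡bx₁ same)) ⟩
    suc k                      ∎
    where open ≤-Reasoning

  has-child : ∀ {v} → 1 ≤ depth v → degree G v ≢ 1 → ∃[ w ] IsParent v w
  has-child {v} 1≤d deg≢1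
    with ∃-other-member (Unique.filter⁺ (T? ∘ adj v) {allFin n} (Unique.allFin⁺ n))
                        (∈-filter⁺ (T? ∘ adj v) (∈-allFin (parent v)) (parent-adj 1≤d)) deg≢1
  ... | w , w∈nbrs , w≢pv with edge-joins-parent (proj₂ (∈-filter⁻ (T? ∘ adj v) {xs = allFin n} w∈nbrs))
  ...   | inj₁ (pv≡w , _) = ⊥-elim (w≢pv (sym pv≡w))
  ...   | inj₂ v-parent   = w , v-parent

  record LeafBelow (v : Fin n) : Set where
    field
      leaf        : Fin n
      leaf∈leaves : leaf ∈ leaves
      height      : ℕ
      ancestor≡   : ancestor height leaf ≡ v

  LeafBelow-parent : ∀ {v w} → IsParent v w → LeafBelow w → LeafBelow v
  LeafBelow-parent (pw≡v , _) below = record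
    { leaf        = leaf
    ; leaf∈leaves = leaf∈leaves
    ; height      = suc height
    ; ancestor≡   = trans (ancestor-suc height leaf) (trans (cong parent ancestor≡) pw≡v)
    }
    where open LeafBelow below

  leaf-below : ∀ {R} → (∀ x → depth x ≤ R) → ∀ v → 1 ≤ depth v → LeafBelow v
  leaf-below {R} shallow v 1≤d = descend R v 1≤d (m≤m+n R (depth v))
    where
    descend : ∀ k v → 1 ≤ depth v → R ≤ k + depth v → LeafBelow v
    descend k v 1≤d R≤ with degree G v ≟ 1
    ... | yes deg≡1 = record
      { leaf = v ; leaf∈leaves = ∈-filter⁺ _ (∈-allFin v) (≡⇒≡ᵇ _ _ deg≡1) ; height = 0 ; ancestor≡ = refl }
    ... | no deg≢1 with has-child 1≤d deg≢1 | k
    ...   | w , v-parent@(_ , dw) | zero  = ⊥-elim (1+n≰n (≤-trans (subst (_≤ R) dw (shallow w)) R≤))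
    ...   | w , v-parent@(_ , dw) | suc k = LeafBelow-parent v-parent (descend k w
      (subst (1 ≤_) (sym dw) (s≤s z≤n))
      (subst (R ≤_) (trans (sym (+-suc k (depth v))) (cong (k +_) (sym dw))) R≤))

module Labelling {n : ℕ} {G : Graph n} (tree : IsTree G) (root : Fin n)
                 (t : ℕ) (shallow : ∀ x → Rooted.depth tree root x ≤ suc (t + t)) where
  open GraphLemmas G
  open Rooted tree root
  open LeafBelow

  below : ∀ {v d} → depth v ≡ suc d → LeafBelow v
  below {v} eq = leaf-below shallow v (≤-trans (s≤s z≤n) (≤-reflexive (sym eq)))

  level : ∀ {v d} → depth v ≡ suc (suc d) → Fin t
  level {v} eq = fromℕ< (⌊n/2⌋<m (s≤s⁻¹ (subst (_≤ suc (t + t)) eq (shallow v))))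

  labelAt : ∀ v d → depth v ≡ d → Fin (suc (length leaves * t))
  labelAt v zero          _  = Fin.zero
  labelAt v (suc zero)    _  = Fin.zero
  labelAt v (suc (suc d)) eq = Fin.suc (combine (index (leaf∈leaves (below eq))) (level eq))

  label : Fin n → Fin (suc (length leaves * t))
  label v = labelAt v (depth v) refl

  labelAt-share : ∀ {v v′ d d′} (eq : depth v ≡ d) (eq′ : depth v′ ≡ d′) → 1 ≤ d → 1 ≤ d′ →
                  labelAt v d eq ≡ labelAt v′ d′ eq′ → ShareEndpoint (parent-edge v) (parent-edge v′)
  labelAt-share {d = 1} {1} eq eq′ _ _ _ =
    root , there (here (sym (parent-of-depth-1 eq))) , there (here (sym (parent-of-depth-1 eq′)))
  labelAt-share {v} {v′} {suc (suc d)} {suc (suc d′)} eq eq′ _ _ same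
    with combine-injective (Finₚ.suc-injective same)
  ... | leaf-index≡ , level≡ =
    nearby-ancestors-share {leaf L} {height L} {height L′}
      (ancestor≡ L) (trans (cong (ancestor (height L′)) leaf≡) (ancestor≡ L′))
      (close eq eq′ half≡) (close eq′ eq (sym half≡))
    where
    L : LeafBelow v
    L = below eq
    L′ : LeafBelow v′
    L′ = below eq′
    leaf≡ : leaf L ≡ leaf L′
    leaf≡ = index-injective (setoid _) (leaf∈leaves L) (leaf∈leaves L′) leaf-index≡
    half≡ : ⌊ d /2⌋ ≡ ⌊ d′ /2⌋
    half≡ = trans (sym (toℕ-fromℕ< _)) (trans (cong toℕ level≡) (toℕ-fromℕ< _))
    close : ∀ {u u′ e e′} → depth u ≡ suc (suc e) → depth u′ ≡ suc (suc e′) → ⌊ e /2⌋ ≡ ⌊ e′ /2⌋ →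
            depth u ≤ suc (depth u′)
    close du du′ halves≡ =
      subst₂ _≤_ (sym du) (cong suc (sym du′)) (s≤s (s≤s (⌊m/2⌋≡⌊n/2⌋⇒m≤1+n _ _ halves≡)))

  lower-end : Fin n → Fin n → Fin n
  lower-end u w with depth u <? depth w
  ... | yes _ = w
  ... | no  _ = u

  lower-end-spec : ∀ {u w} → Adj G u w →
                   1 ≤ depth (lower-end u w) × endpoints (parent-edge (lower-end u w)) ⊆ endpoints (u , w)
  lower-end-spec {u} {w} uw with depth u <? depth w | edge-joins-parent uw
  ... | yes u<w | inj₁ (_ , du)    = ⊥-elim (<⇒≱ u<w (subst (depth w ≤_) (sym du) (n≤1+n (depth w))))
  ... | yes _   | inj₂ (pw≡u , dw) = subst (1 ≤_) (sym dw) (s≤s z≤n) ,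
    λ { (here refl) → there (here refl) ; (there (here refl)) → here pw≡u ; (there (there ())) }
  ... | no _    | inj₁ (pu≡w , du) = subst (1 ≤_) (sym du) (s≤s z≤n) ,
    λ { (here refl) → here refl ; (there (here refl)) → there (here pu≡w) ; (there (there ())) }
  ... | no u≮w  | inj₂ (_ , dw)    = ⊥-elim (u≮w (≤-reflexive (sym dw)))

  edge-label : Fin n × Fin n → Fin (suc (length leaves * t))
  edge-label (u , w) = label (lower-end u w)

  edge-label-share : ∀ {u w u′ w′} → Adj G u w → Adj G u′ w′ →
                     edge-label (u , w) ≡ edge-label (u′ , w′) → ShareEndpoint (u , w) (u′ , w′)
  edge-label-share uw u′w′ same with lower-end-spec uw | lower-end-spec u′w′
  ... | 1≤d , ⊆uw | 1≤d′ , ⊆u′w′ with labelAt-share refl refl 1≤d 1≤d′ same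
  ... | z , z∈ , z∈′ = z , ⊆uw z∈ , ⊆u′w′ z∈′

  matching-number≤ : MatchingNumberAtMost G (suc (numLeaves G * t))
  matching-number≤ = matching-bound edge-label edge-label-share

module _ {n : ℕ} {G : Graph n} (tree : IsTree G) where
  open GraphLemmas G
  private module R = Rooted tree

  Radius≤ : Fin n → ℕ → Set
  Radius≤ c r = ∀ x → R.depth c x ≤ r

  -- Moving the root one step towards a farthest vertex y brings every vertex within distance r:
  -- those in the branch of y get closer, and the others are within r − 1 of the old root
  -- because their walks to y pass through it.
  recentre : ∀ {r c} → DiameterAtMost G (r + r) → Radius≤ c (suc r) → ∃[ c′ ] Radius≤ c′ r
  recentre {r} {c} diam radius with Finₚ.all? (λ x → R.depth c x ≤? r)
  ... | yes near = c , near
  ... | no ¬near = branch y , near′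
    where
    open Rooted tree c
    y : Fin n
    y = proj₁ (¬∀⟶∃¬ n _ (λ x → depth x ≤? r) ¬near)
    dy : depth y ≡ suc r
    dy = ≤-antisym (radius y) (≰⇒> (proj₂ (¬∀⟶∃¬ n _ (λ x → depth x ≤? r) ¬near)))
    d-branch : depth (branch y) ≡ 1
    d-branch = depth-branch (≤-trans (s≤s z≤n) (≤-reflexive (sym dy)))
    c-c′ : Adj G c (branch y)
    c-c′ = adj-sym (subst (Adj G (branch y)) (parent-of-depth-1 d-branch) (parent-adj (≤-reflexive (sym d-branch))))
    near′ : Radius≤ (branch y) r
    near′ x with branch x Finₚ.≟ branch y | diam x y
    ... | yes same | _ =
      ≤-trans (R.depth-minimal (branch y) (subst (λ b → Walk G x b _) same (branch-walk x))) (∸-monoˡ-≤ 1 (radius x))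
    ... | no differ | k , k≤ , walk =
      ≤-trans (R.depth-minimal (branch y) (snoc (depth-walk x) c-c′))
              (+-cancelʳ-≤ r (suc (depth x)) r (begin
                suc (depth x) + r ≡⟨ +-suc (depth x) r ⟨
                depth x + suc r   ≡⟨ cong (depth x +_) dy ⟨
                depth x + depth y ≤⟨ walk-across-branches walk differ ⟩
                k                 ≤⟨ k≤ ⟩
                r + r             ∎))
      where open ≤-Reasoning

  centre : ∀ {r} → DiameterAtMost G (r + r) → Fin n → ∃[ c ] Radius≤ c r
  centre {r} diam u = shrink r λ x → eccentric x (diam x u)
    where
    eccentric : ∀ x → ∃[ k ] k ≤ r + r × Walk G x u k → R.depth u x ≤ r + r
    eccentric x (k , k≤ , walk) = ≤-trans (R.depth-minimal u walk) k≤
    shrink : ∀ m {c} → Radius≤ c (r + m) → ∃[ c′ ] Radius≤ c′ r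
    shrink zero    {c} radius = c , λ x → subst (R.depth c x ≤_) (+-identityʳ r) (radius x)
    shrink (suc m) {c} radius = shrink m (proj₂ (recentre
      (DiameterAtMost-mono (+-mono-≤ (m≤m+n r m) (m≤m+n r m)) diam)
      λ x → subst (R.depth c x ≤_) (+-suc r m) (radius x)))

4t+2≡[2t+1]+[2t+1] : ∀ t → 4 * t + 2 ≡ suc (t + t) + suc (t + t)
4t+2≡[2t+1]+[2t+1] = solve-∀

-- The bound holds for every b and t.
lemma2p11 : ∀ (b t : ℕ) → 3 ≤ b → 1 ≤ t →
    ∀ {n : ℕ} (G : Graph n) → IsTree G → numLeaves G ≡ b →
    DiameterAtMost G (4 * t + 2) → MatchingNumberAtMost G (b * t + 1)
lemma2p11 b t _ _ G tree _       _    []                 _        = z≤n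
lemma2p11 b t _ _ G tree leaves≡ diam M@((u , _) ∷ _) matching
  with centre tree (subst (DiameterAtMost G) (4t+2≡[2t+1]+[2t+1] t) diam) u
... | c , radius =
  subst (length M ≤_) (trans (cong (λ l → suc (l * t)) leaves≡) (+-comm 1 (b * t)))
    (Labelling.matching-number≤ tree c t radius M matching)
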